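{- Let $\Gamma$ and $\Sigma$ be regular graphs with coprime valencies, and suppose that both $\Gamma$ and $\Sigma$ are $R$-thin and that $\Sigma$ is vertex-transitive. Let $u\in V(\Gamma)$ and $i,j\in V(\Sigma)$. If $N_\Sigma(i)\cap N_\Sigma(j)\neq\emptyset$, then for any $\sigma\in\mathrm{Aut}(\Gamma\times\Sigma)$ we have $(u,i)^{\sigma\pi_\Gamma}=(u,j)^{\sigma\pi_\Gamma}$.
   Context: Graphs are finite and simple, $\Sigma$ has at least two vertices; $N_\Delta(x)$ is the neighbourhood of $x$ in $\Delta$. The direct product $\Gamma\times\Sigma$ has vertex set $V(\Gamma)\times V(\Sigma)$, with $(u,x)\sim(v,y)$ iff $u\sim v$ in $\Gamma$ and $x\sim y$ in $\Sigma$. A graph is $R$-thin if distinct vertices have distinct neighbourhoods. $\pi_\Gamma:V(\Gamma\times\Sigma)\to V(\Gamma)$ is the projection $(u,i)\mapsto u$; maps act on the right, so $x^{\sigma\pi_\Gamma}$ means apply $\sigma$ then $\pi_\Gamma$. -}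

module Defs where

open import Data.Nat using (ℕ)
open import Data.Bool using (Bool; true; false; T)
open import Data.Fin using (Fin)
open import Data.Fin.Subset using (∣_∣)
open import Data.Vec using (tabulate)
open import Data.Product using (_×_; _,_; ∃-syntax)
open import Relation.Binary.PropositionalEquality using (_≡_; _≢_)
open import Relation.Nullary using (¬_)
open import Function.Bundles using (_↔_; Inverse; _⇔_)

record Graph : Set where
  field
    n     : ℕ
    adj   : Fin n → Fin n → Bool
    sym   : ∀ x y → adj x y ≡ adj y x
    irrefl : ∀ x → adj x x ≡ false
open Graph public

Adj : (G : Graph) → Fin (n G) → Fin (n G) → Set
Adj G x y = T (adj G x y)

degree : (G : Graph) → Fin (n G) → ℕ
degree G x = ∣ tabulate (adj G x) ∣

IsRegular : Graph → ℕ → Set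
IsRegular G k = ∀ x → degree G x ≡ k

RThin : Graph → Set
RThin G = ∀ x y → (∀ z → Adj G x z ⇔ Adj G y z) → x ≡ y

IsAutOf : {V : Set} → (V → V → Set) → V ↔ V → Set
IsAutOf E σ = ∀ x y → E x y ⇔ E (Inverse.to σ x) (Inverse.to σ y)

Aut : Graph → Set
Aut G = Data.Product.Σ (Fin (n G) ↔ Fin (n G)) (IsAutOf (Adj G))

VertexTransitive : Graph → Set
VertexTransitive G = ∀ x y → ∃[ σ ] (Inverse.to (Data.Product.proj₁ {B = IsAutOf (Adj G)} σ) x ≡ y)

ProdAdj : (Γ Σ : Graph) → Fin (n Γ) × Fin (n Σ) → Fin (n Γ) × Fin (n Σ) → Set
ProdAdj Γ Σ (u , x) (v , y) = Adj Γ u v × Adj Σ x y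

ProdAut : Graph → Graph → Set
ProdAut Γ Σ = Data.Product.Σ ((Fin (n Γ) × Fin (n Σ)) ↔ (Fin (n Γ) × Fin (n Σ))) (IsAutOf (ProdAdj Γ Σ))

module Submission where

-- An automorphism σ of Γ × Σ preserves common neighbourhoods, hence their sizes
-- |N(a) ∩ N(b)| · |N(i) ∩ N(j)|, and the property of a pair x, y that no z has strictly more
-- common neighbours with x and with y than x and y have with each other ("undominated").
-- For x = (u,i) and y = (u,j): if σx and σy share their Σ-coordinate, counting gives
-- k · |N(i) ∩ N(j)| = a · l with 0 < a ≤ k, so coprimality forces a = k and, by thinness,
-- equal Γ-coordinates. Otherwise argue by induction on |N(i) ∩ N(j)|, downwards: if z dominates
-- x, y then z₂ dominates i, j in Σ, so σ(u,i), σ(u,z₂), σ(u,j) agree in Γ by induction;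
-- hence x, y may be assumed undominated; then so are σx, σy, whereas by thinness a pair differing
-- in both coordinates with a common neighbour is dominated. An isolated u forces k = 0, l = 1.

open import Defs renaming (sym to adj-sym)
open import Data.Nat using (ℕ; zero; suc; _+_; _*_; _∸_; _≤_; _<_; >-nonZero)
open import Data.Nat.Properties
  using (+-*-semiring; +-assoc; *-comm; ≤-trans; ≤-reflexive; <-irrefl; m≤n⇒m<n∨m≡n; ∸-monoʳ-<)
open import Data.Nat.Coprimality using (Coprime; coprime-divisor)
open import Data.Nat.Divisibility using (_∣_; divides; ∣⇒≤; _∣0; ∣-refl)
open import Data.Nat.Induction using (<-wellFounded)
open import Induction.WellFounded using (Acc; acc)
open import Data.Bool using (Bool; true; false; T; _∧_; if_then_else_)
open import Data.Bool.Properties using (T-≡; T-∧; ∧-idem)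
open import Data.Fin using (Fin; zero; suc; _↑ˡ_; _↑ʳ_; combine; remQuot)
open import Data.Fin.Properties using (_≟_; remQuot-combine; *↔×)
open import Data.Fin.Subset as S using (Subset; ∣_∣; _∈_)
open import Data.Fin.Subset.Properties
  using (p⊆q⇒∣p∣≤∣q∣; p⊂q⇒∣p∣<∣q∣; _∈?_; nonempty?; Empty-unique; ∣⊥∣≡0; x∈⁅y⁆⇒x≡y; ∣⁅x⁆∣≡1)
open import Data.Vec using (tabulate)
open import Data.Vec.Properties using (lookup∘tabulate; tabulate-cong; []=⇒lookup; lookup⇒[]=)
open import Data.Product using (_×_; _,_; ∃-syntax; proj₁; proj₂)
open import Data.Sum using (inj₁; inj₂)
open import Data.Empty using (⊥-elim)
open import Function using (_∘_)
open import Function.Bundles using (_↔_; _⇔_; Inverse; Equivalence; mk⇔)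
open import Function.Properties.Inverse using (↔-trans; ↔-sym)
open import Relation.Nullary using (¬_; yes; no)
open import Relation.Unary using (Pred; _⊆_; _⊂_)
open import Relation.Binary.PropositionalEquality
open import Algebra.Properties.Semiring.Sum +-*-semiring
  using (sum; sum-cong-≗; sum-permute; *-distribˡ-sum; *-distribʳ-sum)

sum-↑ : ∀ m {n} (f : Fin (m + n) → ℕ) → sum f ≡ sum (f ∘ (_↑ˡ n)) + sum (f ∘ (m ↑ʳ_))
sum-↑ zero    f = refl
sum-↑ (suc m) f = trans (cong (f zero +_) (sum-↑ m (f ∘ suc))) (sym (+-assoc (f zero) _ _))

sum² : ∀ {m n} → (Fin m × Fin n → ℕ) → ℕ
sum² h = sum (λ u → sum (λ j → h (u , j)))

sum-combine : ∀ m {n} (f : Fin (m * n) → ℕ) → sum f ≡ sum² {m} {n} (λ (u , j) → f (combine u j))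
sum-combine zero    f = refl
sum-combine (suc m) {n} f =
  trans (sum-↑ n f) (cong (sum (λ j → f (j ↑ˡ (m * n))) +_) (sum-combine m (f ∘ (n ↑ʳ_))))

sum²-remQuot : ∀ {m n} (h : Fin m × Fin n → ℕ) → sum² h ≡ sum (h ∘ remQuot n)
sum²-remQuot {m} {n} h = sym (trans (sum-combine m (h ∘ remQuot n))
  (sum-cong-≗ (λ u → sum-cong-≗ (λ j → cong h (remQuot-combine {m} {n} u j)))))

sum²-permute : ∀ {m n} (h : Fin m × Fin n → ℕ) (π : (Fin m × Fin n) ↔ (Fin m × Fin n)) →
               sum² h ≡ sum² (h ∘ Inverse.to π)
sum²-permute {m} {n} h π = begin
  sum² h                              ≡⟨ sum²-remQuot h ⟩
  sum (h ∘ remQuot n)                 ≡⟨ sum-permute (h ∘ remQuot n) π′ ⟩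
  sum (h ∘ remQuot n ∘ Inverse.to π′) ≡⟨ sum-cong-≗ {m * n} (λ t → cong h (Inverse.strictlyInverseˡ (*↔× {m} {n}) _)) ⟩
  sum (h ∘ Inverse.to π ∘ remQuot n)  ≡⟨ sum²-remQuot (h ∘ Inverse.to π) ⟨
  sum² (h ∘ Inverse.to π)             ∎
  where
  open ≡-Reasoning
  π′ : Fin (m * n) ↔ Fin (m * n)
  π′ = ↔-trans *↔× (↔-trans π (↔-sym *↔×))

sum²-* : ∀ {m n} (f : Fin m → ℕ) (g : Fin n → ℕ) → sum² (λ (u , j) → f u * g j) ≡ sum f * sum g
sum²-* f g = begin
  sum (λ u → sum (λ j → f u * g j)) ≡⟨ sum-cong-≗ (λ u → *-distribˡ-sum (f u) g) ⟨
  sum (λ u → f u * sum g)           ≡⟨ *-distribʳ-sum (sum g) f ⟨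
  sum f * sum g                     ∎
  where open ≡-Reasoning

indicator : Bool → ℕ
indicator b = if b then 1 else 0

indicator-∧ : ∀ a b → indicator (a ∧ b) ≡ indicator a * indicator b
indicator-∧ false b     = refl
indicator-∧ true  false = refl
indicator-∧ true  true  = refl

T-injective : ∀ {a b} → (T a → T b) → (T b → T a) → a ≡ b
T-injective {false} {false} _ _ = refl
T-injective {false} {true}  _ g = ⊥-elim (g _)
T-injective {true}  {false} f _ = ⊥-elim (f _)
T-injective {true}  {true}  _ _ = refl

∣tabulate∣≡sum : ∀ {n} (p : Fin n → Bool) → ∣ tabulate p ∣ ≡ sum (indicator ∘ p)
∣tabulate∣≡sum {zero}  p = refl
∣tabulate∣≡sum {suc n} p with p zero
... | true  = cong suc (∣tabulate∣≡sum (p ∘ suc))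
... | false = ∣tabulate∣≡sum (p ∘ suc)

∈-tabulate : ∀ {n} {p : Fin n → Bool} {x} → x ∈ tabulate p ⇔ T (p x)
∈-tabulate {p = p} {x} = mk⇔
  (λ x∈p → Equivalence.from T-≡ (trans (sym (lookup∘tabulate p x)) ([]=⇒lookup x∈p)))
  (λ px → lookup⇒[]= x (tabulate p) (trans (lookup∘tabulate p x) (Equivalence.to T-≡ px)))

module _ {n} {p q : Subset n} where

  p⊆q⇒∣q∣≤∣p∣⇒q⊆p : p S.⊆ q → ∣ q ∣ ≤ ∣ p ∣ → q S.⊆ p
  p⊆q⇒∣q∣≤∣p∣⇒q⊆p p⊆q ∣q∣≤∣p∣ {x} x∈q with x ∈? p
  ... | yes x∈p = x∈p
  ... | no  x∉p = ⊥-elim (<-irrefl refl (≤-trans (p⊂q⇒∣p∣<∣q∣ (p⊆q , x , x∈q , x∉p)) ∣q∣≤∣p∣))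

  p⊆q⇒q⊈p⇒∣p∣<∣q∣ : p S.⊆ q → ¬ (q S.⊆ p) → ∣ p ∣ < ∣ q ∣
  p⊆q⇒q⊈p⇒∣p∣<∣q∣ p⊆q q⊈p with m≤n⇒m<n∨m≡n (p⊆q⇒∣p∣≤∣q∣ p⊆q)
  ... | inj₁ ∣p∣<∣q∣ = ∣p∣<∣q∣
  ... | inj₂ ∣p∣≡∣q∣ = ⊥-elim (q⊈p (p⊆q⇒∣q∣≤∣p∣⇒q⊆p p⊆q (≤-reflexive (sym ∣p∣≡∣q∣))))

x∈p⇒0<∣p∣ : ∀ {n} {p : Subset n} {x} → x ∈ p → 0 < ∣ p ∣
x∈p⇒0<∣p∣ {p = p} {x} x∈p =
  subst (_≤ ∣ p ∣) (∣⁅x⁆∣≡1 x) (p⊆q⇒∣p∣≤∣q∣ (λ y∈⁅x⁆ → subst (_∈ p) (sym (x∈⁅y⁆⇒x≡y x y∈⁅x⁆)) x∈p))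

N : (G : Graph) → Fin (n G) → Subset (n G)
N G x = tabulate (adj G x)

isCommonNeighbour : (G : Graph) → Fin (n G) → Fin (n G) → Fin (n G) → Bool
isCommonNeighbour G x y z = adj G x z ∧ adj G y z

commonNeighbours : (G : Graph) → Fin (n G) → Fin (n G) → Subset (n G)
commonNeighbours G x y = tabulate (isCommonNeighbour G x y)

CommonNeighbour : {V : Set} → (V → V → Set) → V → V → Pred V _
CommonNeighbour E x y w = E x w × E y w

NeighbourhoodAntichain : Graph → Set
NeighbourhoodAntichain G = ∀ {x y} → Adj G x ⊆ Adj G y → x ≡ y

module _ (G : Graph) where

  Adj-sym : ∀ {x y} → Adj G x y → Adj G y x
  Adj-sym {x} {y} = subst T (adj-sym G x y)

  ∈N⇔Adj : ∀ {x y} → y ∈ N G x ⇔ Adj G x y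
  ∈N⇔Adj = ∈-tabulate

  ∈commonNeighbours⇔ : ∀ {x y z} → z ∈ commonNeighbours G x y ⇔ CommonNeighbour (Adj G) x y z
  ∈commonNeighbours⇔ = mk⇔ (Equivalence.to T-∧ ∘ Equivalence.to ∈-tabulate)
                            (Equivalence.from ∈-tabulate ∘ Equivalence.from T-∧)

  commonNeighbours⊆N : ∀ {x y} → commonNeighbours G x y S.⊆ N G x
  commonNeighbours⊆N = Equivalence.from ∈N⇔Adj ∘ proj₁ ∘ Equivalence.to ∈commonNeighbours⇔

  ⊂⇒∣commonNeighbours∣< : ∀ {x y x′ y′} →
    CommonNeighbour (Adj G) x y ⊂ CommonNeighbour (Adj G) x′ y′ →
    ∣ commonNeighbours G x y ∣ < ∣ commonNeighbours G x′ y′ ∣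
  ⊂⇒∣commonNeighbours∣< (sub , ¬sup) = p⊆q⇒q⊈p⇒∣p∣<∣q∣
    (λ z∈C → Equivalence.from ∈commonNeighbours⇔ (sub (Equivalence.to ∈commonNeighbours⇔ z∈C)))
    (λ sup → ¬sup (λ z∈C → Equivalence.to ∈commonNeighbours⇔ (sup (Equivalence.from ∈commonNeighbours⇔ z∈C))))

module _ (G : Graph) {k : ℕ} (reg : IsRegular G k) where

  regular-thin⇒antichain : RThin G → NeighbourhoodAntichain G
  regular-thin⇒antichain thin {x} {y} x⊆y =
    thin x y (λ z → mk⇔ x⊆y (λ y~z → Equivalence.to (∈N⇔Adj G) (Ny⊆Nx (Equivalence.from (∈N⇔Adj G) y~z))))
    where
    Ny⊆Nx : N G y S.⊆ N G x
    Ny⊆Nx = p⊆q⇒∣q∣≤∣p∣⇒q⊆p (λ z∈Nx → Equivalence.from (∈N⇔Adj G) (x⊆y (Equivalence.to (∈N⇔Adj G) z∈Nx)))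
      (≤-reflexive (trans (reg y) (sym (reg x))))

  ∣commonNeighbours∣≤k : ∀ x y → ∣ commonNeighbours G x y ∣ ≤ k
  ∣commonNeighbours∣≤k x y = subst (_ ≤_) (reg x) (p⊆q⇒∣p∣≤∣q∣ (commonNeighbours⊆N G))

  ∣commonNeighbours-diag∣ : ∀ x → ∣ commonNeighbours G x x ∣ ≡ k
  ∣commonNeighbours-diag∣ x = trans (cong ∣_∣ (tabulate-cong (λ z → ∧-idem (adj G x z)))) (reg x)

  k≤∣commonNeighbours∣⇒≡ : RThin G → ∀ {x y} → k ≤ ∣ commonNeighbours G x y ∣ → x ≡ y
  k≤∣commonNeighbours∣⇒≡ thin {x} k≤∣C∣ = regular-thin⇒antichain thin
    (proj₂ ∘ Equivalence.to (∈commonNeighbours⇔ G) ∘ Nx⊆C ∘ Equivalence.from (∈N⇔Adj G))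
    where
    Nx⊆C : N G x S.⊆ commonNeighbours G x _
    Nx⊆C = p⊆q⇒∣q∣≤∣p∣⇒q⊆p (commonNeighbours⊆N G) (subst (_≤ _) (sym (reg x)) k≤∣C∣)

1-regular⇒neighbour-unique : ∀ (G : Graph) → IsRegular G 1 → ∀ {i j m} → Adj G i m → Adj G j m → i ≡ j
1-regular⇒neighbour-unique G reg {i} {j} {m} i~m j~m =
  sym (x∈⁅y⁆⇒x≡y i (Nm⊆⁅i⁆ (Equivalence.from (∈N⇔Adj G) (Adj-sym G j~m))))
  where
  ⁅i⁆⊆Nm : S.⁅ i ⁆ S.⊆ N G m
  ⁅i⁆⊆Nm y∈⁅i⁆ = subst (_∈ N G m) (sym (x∈⁅y⁆⇒x≡y i y∈⁅i⁆)) (Equivalence.from (∈N⇔Adj G) (Adj-sym G i~m))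
  Nm⊆⁅i⁆ : N G m S.⊆ S.⁅ i ⁆
  Nm⊆⁅i⁆ = p⊆q⇒∣q∣≤∣p∣⇒q⊆p ⁅i⁆⊆Nm (≤-reflexive (trans (reg m) (sym (∣⁅x⁆∣≡1 i))))

module _ {V : Set} (E : V → V → Set) where

  Dominates : V → V → V → Set
  Dominates z x y = CommonNeighbour E x y ⊂ CommonNeighbour E x z × CommonNeighbour E x y ⊂ CommonNeighbour E y z

  Undominated : V → V → Set
  Undominated x y = ∀ z → ¬ Dominates z x y

module _ {V : Set} {E : V → V → Set} (σ : V ↔ V) (aut : IsAutOf E σ) where

  open Inverse σ using (to; from; strictlyInverseˡ)

  CommonNeighbour-aut : ∀ {x y w} → CommonNeighbour E x y w ⇔ CommonNeighbour E (to x) (to y) (to w)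
  CommonNeighbour-aut {x} {y} {w} = mk⇔
    (λ (x~w , y~w) → Equivalence.to (aut x w) x~w , Equivalence.to (aut y w) y~w)
    (λ (x~w , y~w) → Equivalence.from (aut x w) x~w , Equivalence.from (aut y w) y~w)

  ⊆-aut : ∀ {x y x′ y′} → CommonNeighbour E x y ⊆ CommonNeighbour E x′ y′ →
          CommonNeighbour E (to x) (to y) ⊆ CommonNeighbour E (to x′) (to y′)
  ⊆-aut {x} {y} {x′} {y′} sub {w′} w′∈ =
    subst (CommonNeighbour E (to x′) (to y′)) (strictlyInverseˡ w′)
      (Equivalence.to CommonNeighbour-aut (sub (Equivalence.from CommonNeighbour-aut
        (subst (CommonNeighbour E (to x) (to y)) (sym (strictlyInverseˡ w′)) w′∈))))

  ⊆-aut⁻ : ∀ {x y x′ y′} → CommonNeighbour E (to x) (to y) ⊆ CommonNeighbour E (to x′) (to y′) →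
           CommonNeighbour E x y ⊆ CommonNeighbour E x′ y′
  ⊆-aut⁻ sub w∈ = Equivalence.from CommonNeighbour-aut (sub (Equivalence.to CommonNeighbour-aut w∈))

  ⊂-aut⁻ : ∀ {x y x′ y′} → CommonNeighbour E (to x) (to y) ⊂ CommonNeighbour E (to x′) (to y′) →
           CommonNeighbour E x y ⊂ CommonNeighbour E x′ y′
  ⊂-aut⁻ (sub , ¬sup) = ⊆-aut⁻ sub , ¬sup ∘ ⊆-aut

  Undominated-aut : ∀ {x y} → Undominated E x y → Undominated E (to x) (to y)
  Undominated-aut undom z′ dom with from z′ | strictlyInverseˡ z′
  ... | z | refl = undom z (⊂-aut⁻ (proj₁ dom) , ⊂-aut⁻ (proj₂ dom))

module _ (Γ Σ : Graph) where

  private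
    V : Set
    V = Fin (n Γ) × Fin (n Σ)

  ⊂-project : ∀ {u a i j i′} {z : V} → Adj Γ u a →
    CommonNeighbour (ProdAdj Γ Σ) (u , i) (u , j) ⊂ CommonNeighbour (ProdAdj Γ Σ) (u , i′) z →
    CommonNeighbour (Adj Σ) i j ⊂ CommonNeighbour (Adj Σ) i′ (proj₂ z)
  ⊂-project {a = a} u~a (sub , ¬sup) =
    (λ {b} (i~b , j~b) → let ((_ , i′~b) , (_ , z~b)) = sub {a , b} ((u~a , i~b) , (u~a , j~b)) in i′~b , z~b) ,
    (λ sup → ¬sup (λ ((u~c , i′~b) , (_ , z~b)) → let (i~b , j~b) = sup (i′~b , z~b) in (u~c , i~b) , (u~c , j~b)))

  Dominates-project : ∀ {u a i j} {z : V} → Adj Γ u a →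
    Dominates (ProdAdj Γ Σ) z (u , i) (u , j) → Dominates (Adj Σ) (proj₂ z) i j
  Dominates-project u~a (x⊂ , y⊂) = ⊂-project u~a x⊂ , ⊂-project u~a y⊂

  Dominates-mixed : NeighbourhoodAntichain Γ → NeighbourhoodAntichain Σ →
    ∀ {a b i j} {w : V} → a ≢ b → i ≢ j → CommonNeighbour (ProdAdj Γ Σ) (a , i) (b , j) w →
    Dominates (ProdAdj Γ Σ) (a , j) (a , i) (b , j)
  Dominates-mixed antichainΓ antichainΣ a≢b i≢j ((a~c , i~m) , (b~c , j~m)) =
    ( (λ (x~v@(a~v , _) , (_ , j~v)) → x~v , (a~v , j~v))
    , λ sub → a≢b (antichainΓ (λ a~d → proj₁ (proj₂ (sub ((a~d , i~m) , (a~d , j~m)))))) )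
    ,
    ( (λ ((a~v , _) , y~v@(_ , j~v)) → y~v , (a~v , j~v))
    , λ sub → i≢j (sym (antichainΣ (λ j~e → proj₂ (proj₁ (sub ((b~c , j~e) , (a~c , j~e))))))) )

  isCommonNeighbour× : V → V → V → Bool
  isCommonNeighbour× (a , i) (b , j) (c , m) = isCommonNeighbour Γ a b c ∧ isCommonNeighbour Σ i j m

  T-isCommonNeighbour× : ∀ {x y w} → T (isCommonNeighbour× x y w) ⇔ CommonNeighbour (ProdAdj Γ Σ) x y w
  T-isCommonNeighbour× = mk⇔
    (λ t → let ((a~c , b~c) , (i~m , j~m)) = to T-∧-×-T t in (a~c , i~m) , (b~c , j~m))
    (λ ((a~c , i~m) , (b~c , j~m)) → from T-∧-×-T ((a~c , b~c) , (i~m , j~m)))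
    where
    open Equivalence
    T-∧-×-T : ∀ {p q r s} → T ((p ∧ q) ∧ (r ∧ s)) ⇔ ((T p × T q) × (T r × T s))
    T-∧-×-T = mk⇔ (λ t → let (pq , rs) = to T-∧ t in to T-∧ pq , to T-∧ rs)
                  (λ (pq , rs) → from T-∧ (from T-∧ pq , from T-∧ rs))

  commonNeighbourCount : V → V → ℕ
  commonNeighbourCount x y = sum² (indicator ∘ isCommonNeighbour× x y)

  commonNeighbourCount-× : ∀ a b i j →
    commonNeighbourCount (a , i) (b , j) ≡ ∣ commonNeighbours Γ a b ∣ * ∣ commonNeighbours Σ i j ∣
  commonNeighbourCount-× a b i j = begin
    commonNeighbourCount (a , i) (b , j)
      ≡⟨ sum-cong-≗ (λ c → sum-cong-≗ (λ m → indicator-∧ (isCommonNeighbour Γ a b c) (isCommonNeighbour Σ i j m))) ⟩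
    sum² {n Γ} {n Σ} (λ (c , m) → indicator (isCommonNeighbour Γ a b c) * indicator (isCommonNeighbour Σ i j m))
      ≡⟨ sum²-* (indicator ∘ isCommonNeighbour Γ a b) (indicator ∘ isCommonNeighbour Σ i j) ⟩
    sum (indicator ∘ isCommonNeighbour Γ a b) * sum (indicator ∘ isCommonNeighbour Σ i j)
      ≡⟨ cong₂ _*_ (∣tabulate∣≡sum (isCommonNeighbour Γ a b)) (∣tabulate∣≡sum (isCommonNeighbour Σ i j)) ⟨
    ∣ commonNeighbours Γ a b ∣ * ∣ commonNeighbours Σ i j ∣ ∎
    where open ≡-Reasoning

  commonNeighbourCount-aut : ∀ (σ : ProdAut Γ Σ) x y →
    commonNeighbourCount (Inverse.to (proj₁ σ) x) (Inverse.to (proj₁ σ) y) ≡ commonNeighbourCount x y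
  commonNeighbourCount-aut (σ , aut) x y =
    trans (sum²-permute _ σ) (sum-cong-≗ (λ c → sum-cong-≗ (λ m → cong indicator (isCommonNeighbour×-aut (c , m)))))
    where
    open Equivalence
    isCommonNeighbour×-aut : ∀ w → isCommonNeighbour× (Inverse.to σ x) (Inverse.to σ y) (Inverse.to σ w)
                                 ≡ isCommonNeighbour× x y w
    isCommonNeighbour×-aut w = T-injective
      (λ t → from T-isCommonNeighbour× (from (CommonNeighbour-aut σ aut {x} {y} {w}) (to T-isCommonNeighbour× t)))
      (λ t → from T-isCommonNeighbour× (to (CommonNeighbour-aut σ aut {x} {y} {w}) (to T-isCommonNeighbour× t)))

coprime-*≡*⇒∣ : ∀ {k l c a} → Coprime k l → k * c ≡ a * l → k ∣ a
coprime-*≡*⇒∣ {k} {l} {c} {a} cop eq =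
  coprime-divisor cop (divides c (trans (*-comm l a) (trans (sym eq) (*-comm k c))))

module _ (Γ Σ : Graph) {k l : ℕ} (regΓ : IsRegular Γ k) (regΣ : IsRegular Σ l) (cop : Coprime k l)
         (thinΓ : RThin Γ) (thinΣ : RThin Σ) (σ : ProdAut Γ Σ) where

  private
    V : Set
    V = Fin (n Γ) × Fin (n Σ)

  open Inverse (proj₁ σ) using (to)

  σπΓ : V → Fin (n Γ)
  σπΓ = proj₁ ∘ to

  σπΣ : V → Fin (n Σ)
  σπΣ = proj₂ ∘ to

  σπΓ-sameΣ : ∀ {u i j w} → CommonNeighbour (ProdAdj Γ Σ) (u , i) (u , j) w →
              σπΣ (u , i) ≡ σπΣ (u , j) → σπΓ (u , i) ≡ σπΓ (u , j)
  σπΓ-sameΣ {u} {i} {j} w∈ eqΣ =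
    k≤∣commonNeighbours∣⇒≡ Γ regΓ thinΓ (∣⇒≤ ⦃ >-nonZero 0<a ⦄ (coprime-*≡*⇒∣ cop count))
    where
    a : ℕ
    a = ∣ commonNeighbours Γ (σπΓ (u , i)) (σπΓ (u , j)) ∣
    count : k * ∣ commonNeighbours Σ i j ∣ ≡ a * l
    count = begin
      k * ∣ commonNeighbours Σ i j ∣
        ≡⟨ cong (_* _) (∣commonNeighbours-diag∣ Γ regΓ u) ⟨
      ∣ commonNeighbours Γ u u ∣ * ∣ commonNeighbours Σ i j ∣
        ≡⟨ commonNeighbourCount-× Γ Σ u u i j ⟨
      commonNeighbourCount Γ Σ (u , i) (u , j)
        ≡⟨ commonNeighbourCount-aut Γ Σ σ _ _ ⟨
      commonNeighbourCount Γ Σ (to (u , i)) (to (u , j))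
        ≡⟨ commonNeighbourCount-× Γ Σ _ _ _ _ ⟩
      a * ∣ commonNeighbours Σ (σπΣ (u , i)) (σπΣ (u , j)) ∣
        ≡⟨ cong (λ v → a * ∣ commonNeighbours Σ (σπΣ (u , i)) v ∣) eqΣ ⟨
      a * ∣ commonNeighbours Σ (σπΣ (u , i)) (σπΣ (u , i)) ∣
        ≡⟨ cong (a *_) (∣commonNeighbours-diag∣ Σ regΣ _) ⟩
      a * l ∎
      where open ≡-Reasoning
    0<a : 0 < a
    0<a with Equivalence.to (CommonNeighbour-aut (proj₁ σ) (proj₂ σ)) w∈
    ... | (x~w , _) , (y~w , _) = x∈p⇒0<∣p∣ (Equivalence.from (∈commonNeighbours⇔ Γ) (x~w , y~w))

  σπΓ-undominated : ∀ {u i j w} → CommonNeighbour (ProdAdj Γ Σ) (u , i) (u , j) w →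
                    Undominated (ProdAdj Γ Σ) (to (u , i)) (to (u , j)) → σπΓ (u , i) ≡ σπΓ (u , j)
  σπΓ-undominated {u} {i} {j} w∈ undom with σπΣ (u , i) ≟ σπΣ (u , j)
  ... | yes eqΣ = σπΓ-sameΣ w∈ eqΣ
  ... | no ≢Σ with σπΓ (u , i) ≟ σπΓ (u , j)
  ...   | yes eqΓ = eqΓ
  ...   | no ≢Γ = ⊥-elim (undom _ (Dominates-mixed Γ Σ
    (regular-thin⇒antichain Γ regΓ thinΓ) (regular-thin⇒antichain Σ regΣ thinΣ) ≢Γ ≢Σ
    (Equivalence.to (CommonNeighbour-aut (proj₁ σ) (proj₂ σ)) w∈)))

  σπΓ-unless-dominated : ∀ {u i j w} → CommonNeighbour (ProdAdj Γ Σ) (u , i) (u , j) w →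
    (∀ z → Dominates (ProdAdj Γ Σ) z (u , i) (u , j) → σπΓ (u , i) ≡ σπΓ (u , j)) →
    σπΓ (u , i) ≡ σπΓ (u , j)
  σπΓ-unless-dominated {u} {i} {j} w∈ dominated⇒≡ with σπΓ (u , i) ≟ σπΓ (u , j)
  ... | yes eqΓ = eqΓ
  ... | no ≢Γ = σπΓ-undominated w∈
    (Undominated-aut (proj₁ σ) (proj₂ σ) (λ z dom → ≢Γ (dominated⇒≡ z dom)))

  σπΓ-common-neighbour : ∀ {u a} → Adj Γ u a → ∀ i j → Acc _<_ (l ∸ ∣ commonNeighbours Σ i j ∣) →
    ∀ {m} → Adj Σ i m → Adj Σ j m → σπΓ (u , i) ≡ σπΓ (u , j)
  σπΓ-common-neighbour {u} u~a i j (acc rs) i~m j~m =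
    σπΓ-unless-dominated ((u~a , i~m) , (u~a , j~m)) λ z dom →
      let (i⊂ , j⊂) = Dominates-project Γ Σ u~a dom in trans (ih i⊂) (sym (ih j⊂))
    where
    ih : ∀ {i′ z′} → CommonNeighbour (Adj Σ) i j ⊂ CommonNeighbour (Adj Σ) i′ z′ → σπΓ (u , i′) ≡ σπΓ (u , z′)
    ih C⊂C′ = σπΓ-common-neighbour u~a _ _
      (rs (∸-monoʳ-< (⊂⇒∣commonNeighbours∣< Σ C⊂C′) (∣commonNeighbours∣≤k Σ regΣ _ _)))
      (proj₁ (proj₁ C⊂C′ (i~m , j~m))) (proj₂ (proj₁ C⊂C′ (i~m , j~m)))

lemma5p1 : (Γ Σ : Graph) → 2 ≤ n Σ → (k l : ℕ) → IsRegular Γ k → IsRegular Σ l → Coprime k l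
    → RThin Γ → RThin Σ → VertexTransitive Σ
    → (u : Fin (n Γ)) (i j : Fin (n Σ))
    → ∃[ m ] (Adj Σ i m × Adj Σ j m)
    → (σ : ProdAut Γ Σ)
    → proj₁ (Inverse.to (proj₁ σ) (u , i)) ≡ proj₁ (Inverse.to (proj₁ σ) (u , j))
lemma5p1 Γ Σ _ k l regΓ regΣ cop thinΓ thinΣ _ u i j (m , i~m , j~m) σ with nonempty? (N Γ u)
... | yes (a , a∈Nu) =
  σπΓ-common-neighbour Γ Σ regΓ regΣ cop thinΓ thinΣ σ
    (Equivalence.to (∈N⇔Adj Γ) a∈Nu) i j (<-wellFounded _) i~m j~m
... | no Nu-empty =
  cong (λ v → proj₁ (Inverse.to (proj₁ σ) (u , v)))
    (1-regular⇒neighbour-unique Σ (subst (IsRegular Σ) l≡1 regΣ) i~m j~m)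
  where
  k≡0 : k ≡ 0
  k≡0 = trans (sym (regΓ u)) (trans (cong ∣_∣ (Empty-unique Nu-empty)) (∣⊥∣≡0 (n Γ)))
  l≡1 : l ≡ 1
  l≡1 = cop (subst (l ∣_) (sym k≡0) (l ∣0) , ∣-refl)
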